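{- Let $y,z\in\mathbb{Z}_{\ge1}$ with $y\ne z$. Then the $(0,1,y,z)$-hiccup sequence is morphic.
   Context: For $x\in\mathbb{Z}_{\ge0}$ and $y,z\in\mathbb{Z}_{\ge1}$ with $y\ne z$, the $(0,x,y,z)$-hiccup sequence is the integer sequence $(a(n))_{n\ge1}$ defined by $a(1)=x$ and, for $n\ge 2$, $a(n)=a(n-1)+y$ if $n\in\{a(k):1\le k<n\}$, and $a(n)=a(n-1)+z$ otherwise. The characteristic sequence of an increasing integer sequence $(a(n))$ is the binary sequence $(c(m))_{m\ge1}$ with $c(m)=1$ if $m=a(k)$ for some $k$ and $c(m)=0$ otherwise. A binary sequence $(c(m))_{m\ge1}$ is morphic if there exist a finite alphabet $\Sigma$, a morphism $\phi:\Sigma\to\Sigma^*$, a letter $s\in\Sigma$ such that $\phi(s)$ begins with $s$ and the lengths of $\phi^n(s)$ are unbounded (so $w=\phi^\infty(s)=w_1w_2\cdots$ is an infinite fixed point of $\phi$), and a letter-to-letter coding $\pi:\Sigma\to\{0,1\}$ with $c(m)=\pi(w_m)$ for all $m\ge1$. An increasing sequence is morphic if its characteristic sequence is morphic. -}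

module Defs where

open import Data.Nat using (ℕ; zero; suc; _+_; _≤_; _<_)
open import Data.Bool using (Bool; true; false; if_then_else_)
open import Data.List using (List; []; _∷_; length; lookup; concatMap)
open import Data.List.Membership.DecPropositional (Data.Nat._≟_) using (_∈?_)
open import Data.Fin using (Fin; toℕ)
open import Data.Product using (Σ; ∃; ∃-syntax; _×_)
open import Function using (_⇔_)
open import Relation.Binary.PropositionalEquality using (_≡_)
open import Relation.Nullary using (does)

-- Hiccup sequences  (0,x,y,z).
-- prefixRev x y z k = [a(k+1), a(k), ..., a(1)]   (most recent value first)

hiccupStep : (y z n : ℕ) → List ℕ → List ℕ
hiccupStep y z n []            = []   -- never used (prefixes are nonempty)
hiccupStep y z n (p ∷ ps) =
  (p + (if does (n ∈? (p ∷ ps)) then y else z)) ∷ (p ∷ ps)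

prefixRev : (x y z : ℕ) → ℕ → List ℕ
prefixRev x y z zero    = x ∷ []
prefixRev x y z (suc k) = hiccupStep y z (suc (suc k)) (prefixRev x y z k)

headOr0 : List ℕ → ℕ
headOr0 []      = 0
headOr0 (p ∷ _) = p

-- hiccup x y z n = a(n) for n ≥ 1 (1-indexed; the value at 0 is a dummy 0).
hiccup : (x y z : ℕ) → ℕ → ℕ
hiccup x y z zero    = 0
hiccup x y z (suc k) = headOr0 (prefixRev x y z k)

IsCharSeq : (ℕ → ℕ) → (ℕ → Bool) → Set
IsCharSeq a c = ∀ m → 1 ≤ m → (c m ≡ true) ⇔ (∃[ k ] (1 ≤ k × a k ≡ m))

extend : {A : Set} → (A → List A) → List A → List A
extend φ w = concatMap φ w

iterMorph : {A : Set} → (A → List A) → ℕ → A → List A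
iterMorph φ zero    s = s ∷ []
iterMorph φ (suc n) s = extend φ (iterMorph φ n s)

-- w : ℕ → A (1-indexed, w(m) = w_m) is the infinite fixed point φ^∞(s):
-- every φⁿ(s) is a prefix of w.  (Together with unbounded lengths this
-- determines w uniquely.)
IsFixedPointWord : {A : Set} → (A → List A) → A → (ℕ → A) → Set
IsFixedPointWord φ s w =
  ∀ n (i : Fin (length (iterMorph φ n s))) →
    w (suc (toℕ i)) ≡ lookup (iterMorph φ n s) i

Morphic : (ℕ → Bool) → Set
Morphic c =
  Σ ℕ λ N →
  Σ (Fin N → List (Fin N)) λ φ →
  Σ (Fin N) λ s →
  Σ (ℕ → Fin N) λ w →
  Σ (Fin N → Bool) λ π →
    (∃[ rest ] (φ s ≡ s ∷ rest))
    × (∀ B → ∃[ n ] (B < length (iterMorph φ n s)))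
    × IsFixedPointWord φ s w
    × (∀ m → 1 ≤ m → c m ≡ π (w m))

MorphicSeq : (ℕ → ℕ) → Set
MorphicSeq a = ∃[ c ] (IsCharSeq a c × Morphic c)

-- For z ≥ 2 every a(n) with n ≥ 2 exceeds n, so the hiccup rule says that a(n+1) − a(n) is y or z
-- according as n+1 is or is not a term of the sequence. Reading the characteristic word c from
-- position a(n) + 1 to a(n+1) therefore gives the block 0^(y−1)1 or 0^(z−1)1 chosen by c(n+1):
-- c(2)c(3)… is a fixed point of the substitution 0 ↦ 0^(z−1)1, 1 ↦ 0^(y−1)1, and as c(2) = 0 it is
-- generated from 0. Two extra letters account for the leading 1 of c and for c(2), which is both the
-- seed and the first letter of its own block.
-- For z = 1 the sequence is 1, 2, 3, … and its characteristic word is constant.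
module Submission where

open import Defs
open import Data.Bool using (Bool; true; false; if_then_else_)
open import Data.Bool.Properties using (T-≡; ¬-not)
open import Data.Fin using (Fin; toℕ) renaming (zero to fzero; suc to fsuc)
open import Data.List using (List; []; _∷_; _++_; _∷ʳ_; length; lookup; concatMap; map; replicate)
open import Data.Nat.ListAction using (sum)
open import Data.List.Properties using (∷-injectiveʳ; map-++)
open import Data.Nat using (ℕ; zero; suc; _+_; _∸_; _≤_; _<_; z≤n; s≤s; _≟_)
open import Data.List.Membership.DecPropositional _≟_ using (_∈_; _∉_; _∈?_)
open import Data.List.Relation.Unary.Any using (here; there)
open import Data.Nat.Properties
open import Data.Product using (∃-syntax; ∃₂; _×_; _,_)
open import Data.Sum using (inj₁; inj₂)
open import Function using (mk⇔; Equivalence)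
open import Relation.Binary.PropositionalEquality
open import Relation.Nullary.Decidable using (Dec; does; dec-true; dec-false; toWitness; isYes≗does)

window : {A : Set} → (ℕ → A) → ℕ → ℕ → List A
window f m zero    = []
window f m (suc k) = f m ∷ window f (suc m) k

length-window : ∀ {A : Set} (f : ℕ → A) m k → length (window f m k) ≡ k
length-window f m zero    = refl
length-window f m (suc k) = cong suc (length-window f (suc m) k)

window-++ : ∀ {A : Set} (f : ℕ → A) m k l → window f m (k + l) ≡ window f m k ++ window f (m + k) l
window-++ f m zero    l = cong (λ m′ → window f m′ l) (sym (+-identityʳ m))
window-++ f m (suc k) l = cong (f m ∷_) (begin
  window f (suc m) (k + l)
    ≡⟨ window-++ f (suc m) k l ⟩
  window f (suc m) k ++ window f (suc m + k) l
    ≡⟨ cong (λ m′ → window f (suc m) k ++ window f m′ l) (sym (+-suc m k)) ⟩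
  window f (suc m) k ++ window f (m + suc k) l ∎)
  where open ≡-Reasoning

lookup-window : ∀ {A : Set} (f : ℕ → A) m k {xs} → xs ≡ window f m k →
                (i : Fin (length xs)) → lookup xs i ≡ f (m + toℕ i)
lookup-window f m (suc k) refl fzero    = cong f (sym (+-identityʳ m))
lookup-window f m (suc k) refl (fsuc i) =
  trans (lookup-window f (suc m) k refl i) (cong f (sym (+-suc m (toℕ i))))

block : ℕ → List Bool
block l = replicate l false ∷ʳ true

window-block : ∀ (f : ℕ → Bool) m l → (∀ i → m ≤ i → i < m + l → f i ≡ false) →
               f (m + l) ≡ true → window f m (suc l) ≡ block l
window-block f m zero    _      last = cong (_∷ []) (trans (cong f (sym (+-identityʳ m))) last)
window-block f m (suc l) inside last =
  cong₂ _∷_ (inside m ≤-refl (m<m+n m (s≤s z≤n)))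
            (window-block f (suc m) l inside′ (trans (cong f (sym (+-suc m l))) last))
  where
    inside′ : ∀ i → suc m ≤ i → i < suc m + l → f i ≡ false
    inside′ i m<i i<m+l = inside i (<⇒≤ m<i) (subst (i <_) (sym (+-suc m l)) i<m+l)

module HiccupRecursion (x y z : ℕ) where

  prefixRev-nonempty : ∀ n → ∃₂ λ p ps → prefixRev x y z n ≡ p ∷ ps
  prefixRev-nonempty zero = x , [] , refl
  prefixRev-nonempty (suc n) with prefixRev x y z n | prefixRev-nonempty n
  ... | .(p ∷ ps) | p , ps , refl = _ , _ , refl

  prefixRev-suc : ∀ n → prefixRev x y z (suc n) ≡ hiccup x y z (suc (suc n)) ∷ prefixRev x y z n
  prefixRev-suc n with prefixRev x y z n | prefixRev-nonempty n
  ... | .(p ∷ ps) | p , ps , refl = refl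

  hiccup-suc : ∀ n → hiccup x y z (suc (suc n)) ≡
               hiccup x y z (suc n) + (if does (suc (suc n) ∈? prefixRev x y z n) then y else z)
  hiccup-suc n with prefixRev x y z n | prefixRev-nonempty n
  ... | .(p ∷ ps) | p , ps , refl = refl

  ∈-prefixRev⁻ : ∀ {m} n → m ∈ prefixRev x y z n → ∃[ i ] (i ≤ n × hiccup x y z (suc i) ≡ m)
  ∈-prefixRev⁻ zero    (here refl) = zero , z≤n , refl
  ∈-prefixRev⁻ (suc n) m∈ rewrite prefixRev-suc n with m∈
  ... | here refl = suc n , ≤-refl , refl
  ... | there m∈′ with ∈-prefixRev⁻ n m∈′
  ...   | i , i≤n , eq = i , m≤n⇒m≤1+n i≤n , eq

  ∈-prefixRev⁺ : ∀ {i} n → i ≤ n → hiccup x y z (suc i) ∈ prefixRev x y z n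
  ∈-prefixRev⁺ zero    z≤n = here refl
  ∈-prefixRev⁺ (suc n) i≤1+n rewrite prefixRev-suc n with m≤n⇒m<n∨m≡n i≤1+n
  ... | inj₂ refl      = here refl
  ... | inj₁ (s≤s i≤n) = there (∈-prefixRev⁺ n i≤n)

pattern start  = fzero
pattern second = fsuc fzero
pattern mark₀  = fsuc (fsuc fzero)
pattern mark₁  = fsuc (fsuc (fsuc fzero))

module SelfReading (y′ z′ : ℕ) where

  zerosBefore : Bool → ℕ
  zerosBefore true  = y′
  zerosBefore false = suc z′

  gap : Bool → ℕ
  gap b = suc (zerosBefore b)

  blockOf : Bool → List Bool
  blockOf b = block (zerosBefore b)

  length≤sum-gaps : ∀ bs → length bs ≤ sum (map gap bs)
  length≤sum-gaps []       = z≤n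
  length≤sum-gaps (b ∷ bs) = s≤s (≤-trans (length≤sum-gaps bs) (m≤n+m _ (zerosBefore b)))

  letter : Bool → Fin 4
  letter false = mark₀
  letter true  = mark₁

  -- The first 0 of c (at position 2) is spelled by the letter second, whose image is the rest of its block.
  φ : Fin 4 → List (Fin 4)
  φ start  = start ∷ second ∷ []
  φ second = map letter (block z′)
  φ mark₀  = map letter (blockOf false)
  φ mark₁  = map letter (blockOf true)

  π : Fin 4 → Bool
  π start  = true
  π second = false
  π mark₀  = false
  π mark₁  = true

  π-letter : ∀ b → π (letter b) ≡ b
  π-letter false = refl
  π-letter true  = refl

  extend-map-letter : ∀ bs → extend φ (map letter bs) ≡ map letter (concatMap blockOf bs)
  extend-map-letter []       = refl
  extend-map-letter (b ∷ bs) =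
    trans (cong₂ _++_ (φ-letter b) (extend-map-letter bs)) (sym (map-++ letter (blockOf b) (concatMap blockOf bs)))
    where
      φ-letter : ∀ b → φ (letter b) ≡ map letter (blockOf b)
      φ-letter false = refl
      φ-letter true  = refl

  module _ (a : ℕ → ℕ) (c : ℕ → Bool) (a-one : a 1 ≡ 1) (c-two : c 2 ≡ false)
           (a-suc : ∀ n → a (suc (suc n)) ≡ a (suc n) + gap (c (suc (suc n))))
           (char : IsCharSeq a c) where

    a-<-suc : ∀ n → a (suc n) < a (suc (suc n))
    a-<-suc n = subst (a (suc n) <_) (sym (a-suc n)) (m<m+n (a (suc n)) (s≤s z≤n))

    a-strict : ∀ {i j} → i < j → a (suc i) < a (suc j)
    a-strict {i} {suc j} (s≤s i≤j) with m≤n⇒m<n∨m≡n i≤j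
    ... | inj₁ i<j  = <-trans (a-strict i<j) (a-<-suc j)
    ... | inj₂ refl = a-<-suc i

    a-mono : ∀ {i j} → i ≤ j → a (suc i) ≤ a (suc j)
    a-mono i≤j with m≤n⇒m<n∨m≡n i≤j
    ... | inj₁ i<j  = <⇒≤ (a-strict i<j)
    ... | inj₂ refl = ≤-refl

    a-positive : ∀ n → 1 ≤ a (suc n)
    a-positive n = subst (_≤ a (suc n)) a-one (a-mono z≤n)

    c-value : ∀ n → c (a (suc n)) ≡ true
    c-value n = Equivalence.from (char (a (suc n)) (a-positive n)) (suc n , s≤s z≤n , refl)

    c-between : ∀ n m → a (suc n) < m → m < a (suc (suc n)) → c m ≡ false
    c-between n m an<m m<an′ = ¬-not not-value
      where
        not-value : c m ≢ true
        not-value cm with Equivalence.to (char m (≤-trans (s≤s z≤n) an<m)) cm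
        ... | suc i , _ , refl with ≤-<-connex i n
        ...   | inj₁ i≤n = <-irrefl refl (≤-<-trans (a-mono i≤n) an<m)
        ...   | inj₂ n<i = <-irrefl refl (<-≤-trans m<an′ (a-mono n<i))

    block-at : ∀ n → window c (suc (a (suc n))) (gap (c (suc (suc n)))) ≡ blockOf (c (suc (suc n)))
    block-at n = window-block c (suc (a (suc n))) l inside last
      where
        l : ℕ
        l = zerosBefore (c (suc (suc n)))
        next : a (suc (suc n)) ≡ suc (a (suc n) + l)
        next = trans (a-suc n) (+-suc (a (suc n)) l)
        inside : ∀ i → suc (a (suc n)) ≤ i → i < suc (a (suc n)) + l → c i ≡ false
        inside i an<i i<an′ = c-between n i an<i (subst (i <_) (sym next) i<an′)
        last : c (suc (a (suc n)) + l) ≡ true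
        last = subst (λ m → c m ≡ true) next (c-value (suc n))

    blocks-self : ∀ n k → concatMap blockOf (window c (suc (suc n)) k) ≡
                  window c (suc (a (suc n))) (sum (map gap (window c (suc (suc n)) k)))
    blocks-self n zero    = refl
    blocks-self n (suc k) = begin
      blockOf b ++ concatMap blockOf (window c (3 + n) k)
        ≡⟨ cong₂ _++_ (sym (block-at n)) (blocks-self (suc n) k) ⟩
      window c (suc (a (suc n))) (gap b) ++ window c (suc (a (2 + n))) rest
        ≡⟨ cong (λ m → window c (suc (a (suc n))) (gap b) ++ window c (suc m) rest) (a-suc n) ⟩
      window c (suc (a (suc n))) (gap b) ++ window c (suc (a (suc n)) + gap b) rest
        ≡⟨ sym (window-++ c (suc (a (suc n))) (gap b) rest) ⟩
      window c (suc (a (suc n))) (gap b + rest) ∎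
      where
        open ≡-Reasoning
        b : Bool
        b = c (suc (suc n))
        rest : ℕ
        rest = sum (map gap (window c (3 + n) k))

    first-block-self : ∀ k → block z′ ++ concatMap blockOf (window c 3 k) ≡
                       window c 3 (suc z′ + sum (map gap (window c 3 k)))
    first-block-self k = ∷-injectiveʳ (begin
      concatMap blockOf (false ∷ window c 3 k)
        ≡⟨ cong (λ b → concatMap blockOf (b ∷ window c 3 k)) (sym c-two) ⟩
      concatMap blockOf (window c 2 (suc k))
        ≡⟨ blocks-self 0 (suc k) ⟩
      window c (suc (a 1)) (gap (c 2) + rest)
        ≡⟨ cong₂ (λ m b → window c (suc m) (gap b + rest)) a-one c-two ⟩
      window c 2 (gap false + rest) ∎)
      where
        open ≡-Reasoning
        rest : ℕ
        rest = sum (map gap (window c 3 k))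

    w : ℕ → Fin 4
    w zero                = start
    w (suc zero)          = start
    w (suc (suc zero))    = second
    w (suc (suc (suc j))) = letter (c (3 + j))

    window-w : ∀ m k → window w (3 + m) k ≡ map letter (window c (3 + m) k)
    window-w m zero    = refl
    window-w m (suc k) = cong (letter (c (3 + m)) ∷_) (window-w (suc m) k)

    iterMorph-start : ∀ n → ∃[ k ] (n ≤ k ×
                      iterMorph φ (suc n) start ≡ start ∷ second ∷ map letter (window c 3 k))
    iterMorph-start zero = 0 , z≤n , refl
    iterMorph-start (suc n) with iterMorph-start n
    ... | k , n≤k , eq = suc z′ + rest , grows , (begin
      extend φ (iterMorph φ (suc n) start)
        ≡⟨ cong (extend φ) eq ⟩
      start ∷ second ∷ map letter (block z′) ++ extend φ (map letter (window c 3 k))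
        ≡⟨ cong (λ t → start ∷ second ∷ map letter (block z′) ++ t) (extend-map-letter (window c 3 k)) ⟩
      start ∷ second ∷ map letter (block z′) ++ map letter (concatMap blockOf (window c 3 k))
        ≡⟨ cong (λ t → start ∷ second ∷ t) (sym (map-++ letter (block z′) _)) ⟩
      start ∷ second ∷ map letter (block z′ ++ concatMap blockOf (window c 3 k))
        ≡⟨ cong (λ t → start ∷ second ∷ map letter t) (first-block-self k) ⟩
      start ∷ second ∷ map letter (window c 3 (suc z′ + rest)) ∎)
      where
        open ≡-Reasoning
        rest : ℕ
        rest = sum (map gap (window c 3 k))
        k≤rest : k ≤ rest
        k≤rest = subst (_≤ rest) (length-window c 3 k) (length≤sum-gaps (window c 3 k))
        grows : suc n ≤ suc z′ + rest
        grows = s≤s (≤-trans n≤k (≤-trans k≤rest (m≤n+m rest z′)))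

    iterMorph-window : ∀ n → ∃[ k ] (n < k × iterMorph φ n start ≡ window w 1 k)
    iterMorph-window zero = 1 , s≤s z≤n , refl
    iterMorph-window (suc n) with iterMorph-start n
    ... | k , n≤k , eq =
      suc (suc k) , s≤s (s≤s n≤k) , trans eq (cong (λ t → start ∷ second ∷ t) (sym (window-w 0 k)))

    fixed-point : IsFixedPointWord φ start w
    fixed-point n i with iterMorph-window n
    ... | k , _ , eq = sym (lookup-window w 1 k eq i)

    unbounded : ∀ B → ∃[ n ] (B < length (iterMorph φ n start))
    unbounded B with iterMorph-window B
    ... | k , B<k , eq = B , subst (B <_) (sym (trans (cong length eq) (length-window w 1 k))) B<k

    coding : ∀ m → 1 ≤ m → c m ≡ π (w m)
    coding (suc zero)          _ = Equivalence.from (char 1 ≤-refl) (1 , ≤-refl , a-one)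
    coding (suc (suc zero))    _ = c-two
    coding (suc (suc (suc j))) _ = sym (π-letter (c (3 + j)))

    morphic : Morphic c
    morphic = 4 , φ , start , w , π , (second ∷ [] , refl) , unbounded , fixed-point , coding

module _ (y′ z′ : ℕ) where
  private
    y z : ℕ
    y = suc y′
    z = suc (suc z′)

    a : ℕ → ℕ
    a = hiccup 1 y z

    open HiccupRecursion 1 y z
    open SelfReading y′ z′

    -- c m tests whether m occurs among a(1), …, a(max(1, m − 1)): the test of the hiccup rule at step m.
    -- It is the characteristic sequence because a(k) > k for k ≥ 2.
    c : ℕ → Bool
    c m = does (m ∈? prefixRev 1 y z (m ∸ 2))

    a-suc : ∀ n → a (suc (suc n)) ≡ a (suc n) + gap (c (suc (suc n)))
    a-suc n = trans (hiccup-suc n) (cong (a (suc n) +_) (step≡gap (c (suc (suc n)))))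
      where
        step≡gap : ∀ b → (if b then y else z) ≡ gap b
        step≡gap false = refl
        step≡gap true  = refl

    a-beyond-index : ∀ n → 3 + n ≤ a (suc (suc n))
    a-beyond-index zero    = s≤s (s≤s (s≤s z≤n))
    a-beyond-index (suc n) = ≤-trans (s≤s (a-beyond-index n))
                                     (subst (suc (a (2 + n)) ≤_) (sym (a-suc (suc n))) (m<m+n (a (2 + n)) (s≤s z≤n)))

    char : IsCharSeq a c
    char (suc zero)    _ = mk⇔ (λ _ → 1 , ≤-refl , refl) (λ _ → refl)
    char (suc (suc j)) _ = mk⇔ occurs occurs⁻¹
      where
        member? : Dec (2 + j ∈ prefixRev 1 y z j)
        member? = 2 + j ∈? prefixRev 1 y z j
        occurs : c (2 + j) ≡ true → ∃[ k ] (1 ≤ k × a k ≡ 2 + j)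
        occurs e with ∈-prefixRev⁻ j (toWitness {a? = member?} (Equivalence.from T-≡ (trans (isYes≗does member?) e)))
        ... | i , _ , eq = suc i , s≤s z≤n , eq
        occurs⁻¹ : ∃[ k ] (1 ≤ k × a k ≡ 2 + j) → c (2 + j) ≡ true
        occurs⁻¹ (suc (suc i) , _ , eq) =
          dec-true member? (subst (_∈ prefixRev 1 y z j) eq (∈-prefixRev⁺ j i<j))
          where
            i<j : suc i ≤ j
            i<j = ≤-pred (≤-pred (subst (3 + i ≤_) eq (a-beyond-index i)))

  hiccup-morphic-z≥2 : MorphicSeq (hiccup 1 (suc y′) (suc (suc z′)))
  hiccup-morphic-z≥2 = c , char , morphic a c refl refl a-suc char

constant-morphic : ∀ b → Morphic (λ _ → b)
constant-morphic b =
  1 , double , fzero , (λ _ → fzero) , (λ _ → b) , (fzero ∷ [] , refl) ,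
  (λ n → n , n<length n) , (λ n i → only (lookup (iterMorph double n fzero) i)) , (λ _ _ → refl)
  where
    double : Fin 1 → List (Fin 1)
    double _ = fzero ∷ fzero ∷ []

    only : (i : Fin 1) → fzero ≡ i
    only fzero = refl

    length-extend : ∀ xs → length (extend double xs) ≡ length xs + length xs
    length-extend []       = refl
    length-extend (x ∷ xs) = cong suc (trans (cong suc (length-extend xs)) (sym (+-suc (length xs) (length xs))))

    n<length : ∀ n → n < length (iterMorph double n fzero)
    n<length zero    = s≤s z≤n
    n<length (suc n) = ≤-trans (+-mono-≤ {1} (≤-trans (s≤s z≤n) (n<length n)) (n<length n))
                               (≤-reflexive (sym (length-extend (iterMorph double n fzero))))

module _ (y : ℕ) where
  private
    open HiccupRecursion 1 y 1

    hiccup-identity : ∀ n i → i ≤ n → hiccup 1 y 1 (suc i) ≡ suc i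
    hiccup-identity n       zero    _         = refl
    hiccup-identity (suc n) (suc i) (s≤s i≤n) with m≤n⇒m<n∨m≡n i≤n
    ... | inj₁ i<n  = hiccup-identity n (suc i) i<n
    ... | inj₂ refl = begin
      hiccup 1 y 1 (2 + i)
        ≡⟨ hiccup-suc i ⟩
      hiccup 1 y 1 (suc i) + (if does (2 + i ∈? prefixRev 1 y 1 i) then y else 1)
        ≡⟨ cong₂ (λ m b → m + (if b then y else 1))
                 (hiccup-identity i i ≤-refl) (dec-false (2 + i ∈? prefixRev 1 y 1 i) fresh) ⟩
      suc i + 1
        ≡⟨ +-comm (suc i) 1 ⟩
      2 + i ∎
      where
        open ≡-Reasoning
        fresh : 2 + i ∉ prefixRev 1 y 1 i
        fresh 2+i∈ with ∈-prefixRev⁻ i 2+i∈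
        ... | k , k≤i , eq = <-irrefl refl (subst (_≤ suc i) (trans (sym (hiccup-identity i k k≤i)) eq) (s≤s k≤i))

    char : IsCharSeq (hiccup 1 y 1) (λ _ → true)
    char (suc m) _ = mk⇔ (λ _ → suc m , s≤s z≤n , hiccup-identity m m ≤-refl) (λ _ → refl)

  hiccup-morphic-z≡1 : MorphicSeq (hiccup 1 y 1)
  hiccup-morphic-z≡1 = (λ _ → true) , char , constant-morphic true

lemma4 : (y z : ℕ) → 1 ≤ y → 1 ≤ z → y ≢ z → MorphicSeq (hiccup 1 y z)
lemma4 y        (suc zero)     _ _ _ = hiccup-morphic-z≡1 y
lemma4 (suc y′) (suc (suc z′)) _ _ _ = hiccup-morphic-z≥2 y′ z′
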